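{- Let $(A,B)$ be an instance of 3-Partition and let $\Phi(A,B)=(S,\mathrm{val},\mathcal{E},C)$ be the OCP instance constructed from it as described in the context. In any ordered covering $\mathcal{E}'$ of $\Phi(A,B)$ with $F(\mathcal{E}')\le C$, exactly $m$ assignment edges appear in $\mathcal{E}'$ with nonempty residual sets.
   Context: OCP: an instance consists of a finite label set $S$, a family $\mathcal{E}$ of finite sets with $S\subseteq\bigcup\mathcal{E}$, a weight function $\mathrm{val}$ assigning a positive integer to every element of $\bigcup\mathcal{E}$, and a budget $C\in\mathbb{N}$. An ordered covering is a tuple $\mathcal{E}'=(E'_1,\dots,E'_k)$ of members of $\mathcal{E}$ with $S\subseteq\bigcup_i E'_i$; its residual sets are $U_i=E'_i\setminus\bigcup_{j<i}E'_j$ (written $U(E'_i)$), residual weights $u_i=\sum_{x\in U_i}\mathrm{val}(x)$, partial costs $f(E'_i)=2^{u_i}$ if $u_i>0$ and $0$ if $u_i=0$, and total cost $F(\mathcal{E}')=\sum_i f(E'_i)$. 3-Partition: an instance is a multiset $A=\{a_1,\dots,a_{3m}\}$ of positive integers and a positive integer $B$ with $\sum_{i=1}^{3m}a_i=mB$ and $B/4<a_i<B/2$ for all $i$. The construction $\Phi(A,B)$: let $S=\{\alpha_1,\dots,\alpha_{3m}\}$ with $\mathrm{val}(\alpha_\ell)=a_\ell$ (distinct labels even for repeated values). Let $T$ be the collection of all 3-element subsets $X\subseteq S$ with $\sum_{\alpha\in X}\mathrm{val}(\alpha)=B$, enumerated as $X_1,\dots,X_{|T|}$. Set $t=1$ and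 $w=t+B+\lceil\log_2 m\rceil+1$. For each $i\in\{1,\dots,m\}$ and $j\in\{1,\dots,|T|\}$ introduce two new distinct elements $\omega_{ij},\tau_{ij}\notin S$ (all distinct across pairs $(i,j)$) with $\mathrm{val}(\omega_{ij})=w$ and $\mathrm{val}(\tau_{ij})=t$, and define the opening edge $A_{ij}=\{\omega_{ij}\}$ and the assignment edge $E_{ij}=X_j\cup\{\omega_{ij},\tau_{ij}\}$. Let $\mathcal{E}=\{A_{ij},E_{ij}: i\in\{1,\dots,m\}, j\in\{1,\dots,|T|\}\}$ and $C=m(2^w+2^{t+B})$. -}

module Defs where

open import Data.Nat using (ℕ; zero; suc; _+_; _*_; _^_)
open import Data.Nat.Logarithm using (⌈log₂_⌉)
open import Data.Fin using (Fin)
import Data.Fin as Fin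
open import Data.Fin.Subset using (Subset; ∣_∣) renaming (_∈_ to _∈ˢ_)
open import Data.Fin.Subset.Properties using () renaming (_∈?_ to _∈ˢ?_)
open import Data.List using (List; []; _∷_; _++_; map; filter; null; allFin; length)
open import Data.Nat.ListAction using (sum)
open import Data.List.Relation.Unary.Any using (Any; any?)
open import Data.Bool using (Bool; true; false; if_then_else_; not)
open import Relation.Nullary using (Dec; yes; no; ¬?)
open import Relation.Binary using (DecidableEquality)
open import Relation.Binary.PropositionalEquality using (_≡_; refl)

subsetWeight : {k : ℕ} → (Fin k → ℕ) → Subset k → ℕ
subsetWeight {k} a Y = sum (map a (filter (_∈ˢ? Y) (allFin k)))

-- The OCP instance Φ(A,B), given m, |T| = n, weights a, bound B and an
-- enumeration X : Fin n → Subset (3 * m) of T.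

module Construction (m n : ℕ) (a : Fin (3 * m) → ℕ) (B : ℕ)
                    (X : Fin n → Subset (3 * m)) where

  data Elem : Set where
    α : Fin (3 * m) → Elem
    ω : Fin m → Fin n → Elem
    τ : Fin m → Fin n → Elem

  data Edge : Set where
    A : Fin m → Fin n → Edge
    E : Fin m → Fin n → Edge

  isAssignment : Edge → Bool
  isAssignment (A _ _) = false
  isAssignment (E _ _) = true

  t : ℕ
  t = 1

  w : ℕ
  w = t + B + ⌈log₂ m ⌉ + 1

  val : Elem → ℕ
  val (α ℓ) = a ℓ
  val (ω _ _) = w
  val (τ _ _) = t

  C : ℕ
  C = m * (2 ^ w + 2 ^ (t + B))

  -- the (duplicate-free) list of elements of an edge
  elems : Edge → List Elem
  elems (A i j) = ω i j ∷ []
  elems (E i j) = map α (filter (_∈ˢ? X j) (allFin (3 * m))) ++ (ω i j ∷ τ i j ∷ [])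

  _≟ₑ_ : DecidableEquality Elem
  α x ≟ₑ α y with x Fin.≟ y
  ... | yes refl = yes refl
  ... | no ne = no λ { refl → ne refl }
  ω i j ≟ₑ ω k l with i Fin.≟ k | j Fin.≟ l
  ... | yes refl | yes refl = yes refl
  ... | no ne | _ = no λ { refl → ne refl }
  ... | _ | no ne = no λ { refl → ne refl }
  τ i j ≟ₑ τ k l with i Fin.≟ k | j Fin.≟ l
  ... | yes refl | yes refl = yes refl
  ... | no ne | _ = no λ { refl → ne refl }
  ... | _ | no ne = no λ { refl → ne refl }
  α _ ≟ₑ ω _ _ = no λ ()
  α _ ≟ₑ τ _ _ = no λ ()
  ω _ _ ≟ₑ α _ = no λ ()
  ω _ _ ≟ₑ τ _ _ = no λ ()
  τ _ _ ≟ₑ α _ = no λ ()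
  τ _ _ ≟ₑ ω _ _ = no λ ()

  open import Data.List.Membership.DecPropositional _≟ₑ_
    using (_∈_; _∈?_)

  IsCovering : List Edge → Set
  IsCovering Es = (ℓ : Fin (3 * m)) → Any (λ e → α ℓ ∈ elems e) Es

  residual : List Edge → Edge → List Elem
  residual prev e = filter (λ x → ¬? (any? (λ e' → x ∈? elems e') prev)) (elems e)

  residualWeight : List Edge → Edge → ℕ
  residualWeight prev e = sum (map val (residual prev e))

  partialCost : ℕ → ℕ
  partialCost zero = 0
  partialCost (suc u) = 2 ^ suc u

  costFrom : List Edge → List Edge → ℕ
  costFrom prev [] = 0
  costFrom prev (e ∷ es) = partialCost (residualWeight prev e) + costFrom (e ∷ prev) es

  F : List Edge → ℕ
  F = costFrom []

  countFrom : List Edge → List Edge → ℕ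
  countFrom prev [] = 0
  countFrom prev (e ∷ es) =
    (if isAssignment e then (if null (residual prev e) then 0 else 1) else 0)
    + countFrom (e ∷ prev) es

  nonemptyAssignments : List Edge → ℕ
  nonemptyAssignments = countFrom []

-- Follow an ordered covering edge by edge and count, for the prefix placed so far, the covered
-- ω's, τ's and labels α. The residual set of E_ij is nonempty exactly when E_ij is the first edge
-- to cover τ_ij, so the number N of such edges is at most the final number of covered τ's, hence
-- (τ_ij lies only in E_ij, which contains ω_ij) at most the final number of covered ω's. The edge
-- that first covers an ω has residual weight at least w and costs at least 2^w, so
-- 2^w·N ≤ F ≤ m(2^w + 2^(t+B)); as m·2^(t+B) < 2^w, N ≤ m. Conversely, only those N edges
-- cover new labels, at most three each, and all 3m labels get covered, so 3m ≤ 3N.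

module Submission where

open import Defs
open import Data.Nat using (ℕ; zero; suc; _+_; _*_; _^_; _≤_; _<_; z≤n; s≤s; s≤s⁻¹; ⌊_/2⌋; ⌈_/2⌉)
open import Data.Nat.Properties
open import Data.Nat.Logarithm using (⌈log₂_⌉)
open import Data.Nat.Logarithm.Core using (⌈log2⌉)
open import Data.Nat.Induction using (<-wellFounded)
open import Data.Nat.ListAction using (sum)
open import Induction.WellFounded using (Acc; acc)
open import Data.Fin using (Fin; zero; suc)
import Data.Fin.Properties as Fin
open import Data.Fin.Subset using (Subset; ∣_∣; inside; outside) renaming (_∈_ to _∈ˢ_)
open import Data.Fin.Subset.Properties using () renaming (_∈?_ to _∈ˢ?_)
import Data.Vec as Vec
open import Data.List using (List; []; _∷_; map; filter; null; allFin; reverseAcc; reverse)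
open import Data.List.Properties using (filter-none)
open import Data.List.Relation.Unary.Any using (Any; any?; here; there)
import Data.List.Relation.Unary.Any as Any
open import Data.List.Relation.Unary.Any.Properties using (reverse⁺)
import Data.List.Relation.Unary.All as All
open import Data.List.Membership.Propositional using (_∈_)
open import Data.List.Membership.Propositional.Properties using (∈-++⁻; ∈-++⁺ʳ; ∈-filter⁺; ∈-filter⁻; ∈-map∘filter⁻)
open import Data.Bool using (if_then_else_)
open import Data.Product using (∃; ∃-syntax; _×_; _,_; proj₁; proj₂; uncurry)
open import Data.Sum using (_⊎_; inj₁; inj₂)
open import Function using (_∘_)
open import Relation.Nullary using (Dec; yes; no; does; ¬_; ¬?; contradiction)
open import Relation.Binary.PropositionalEquality
open import Algebra.Properties.Semiring.Sum +-*-semiring using (sum-syntax; sum-cong-≗; ∑-distrib-+)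
open import Algebra.Properties.CommutativeSemigroup +-commutativeSemigroup using (xy∙z≈xz∙y)

private variable
  k : ℕ
  P Q R : Set

∑-mono-≤ : {f g : Fin k → ℕ} → (∀ i → f i ≤ g i) → ∑[ i < k ] f i ≤ ∑[ i < k ] g i
∑-mono-≤ {zero}  f≤g = z≤n
∑-mono-≤ {suc k} f≤g = +-mono-≤ (f≤g zero) (∑-mono-≤ (f≤g ∘ suc))

∑-≤-at : {f g : Fin k → ℕ} (i₀ : Fin k) {c d : ℕ} →
         (∀ i → i ≢ i₀ → f i ≤ g i) → f i₀ + c ≤ g i₀ + d →
         ∑[ i < k ] f i + c ≤ ∑[ i < k ] g i + d
∑-≤-at {f = f} {g} zero {c} {d} off at = begin
  f zero + ∑[ i < _ ] f (suc i) + c   ≡⟨ xy∙z≈xz∙y (f zero) (∑[ i < _ ] f (suc i)) c ⟩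
  f zero + c + ∑[ i < _ ] f (suc i)   ≤⟨ +-mono-≤ at (∑-mono-≤ (λ i → off (suc i) λ ())) ⟩
  g zero + d + ∑[ i < _ ] g (suc i)   ≡⟨ xy∙z≈xz∙y (g zero) (∑[ i < _ ] g (suc i)) d ⟨
  g zero + ∑[ i < _ ] g (suc i) + d   ∎
  where open ≤-Reasoning
∑-≤-at {f = f} {g} (suc i₀) {c} {d} off at = begin
  f zero + ∑[ i < _ ] f (suc i) + c     ≡⟨ +-assoc (f zero) _ c ⟩
  f zero + (∑[ i < _ ] f (suc i) + c)   ≤⟨ +-mono-≤ (off zero λ ()) (∑-≤-at i₀ off-suc at) ⟩
  g zero + (∑[ i < _ ] g (suc i) + d)   ≡⟨ +-assoc (g zero) _ d ⟨
  g zero + ∑[ i < _ ] g (suc i) + d     ∎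
  where
  open ≤-Reasoning
  off-suc : ∀ i → i ≢ i₀ → f (suc i) ≤ g (suc i)
  off-suc i i≢i₀ = off (suc i) (i≢i₀ ∘ Fin.suc-injective)

∑²-≤-at : ∀ {m n} {f g : Fin m → Fin n → ℕ} (i₀ : Fin m) (j₀ : Fin n) {c d : ℕ} →
          (∀ i j → (i , j) ≢ (i₀ , j₀) → f i j ≤ g i j) → f i₀ j₀ + c ≤ g i₀ j₀ + d →
          ∑[ i < m ] ∑[ j < n ] f i j + c ≤ ∑[ i < m ] ∑[ j < n ] g i j + d
∑²-≤-at i₀ j₀ off at =
  ∑-≤-at i₀ (λ i i≢i₀ → ∑-mono-≤ λ j → off i j (i≢i₀ ∘ cong proj₁))
            (∑-≤-at j₀ (λ j j≢j₀ → off i₀ j (j≢j₀ ∘ cong proj₂)) at)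

∑-0 : ∀ k → ∑[ i < k ] 0 ≡ 0
∑-0 zero    = refl
∑-0 (suc k) = ∑-0 k

∑-1 : ∀ k → ∑[ i < k ] 1 ≡ k
∑-1 zero    = refl
∑-1 (suc k) = cong suc (∑-1 k)

sum-map-∈ : ∀ {A : Set} (f : A → ℕ) {x xs} → x ∈ xs → f x ≤ sum (map f xs)
sum-map-∈ f (here refl) = m≤m+n _ _
sum-map-∈ f {xs = y ∷ _} (there x∈) = ≤-trans (sum-map-∈ f x∈) (m≤n+m _ (f y))

𝟙 : Dec P → ℕ
𝟙 P? = if does P? then 1 else 0

𝟙-yes : (P? : Dec P) → P → 𝟙 P? ≡ 1
𝟙-yes (yes _) _ = refl
𝟙-yes (no ¬p) p = contradiction p ¬p

𝟙-mono : (P? : Dec P) (Q? : Dec Q) → (P → Q) → 𝟙 P? ≤ 𝟙 Q?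
𝟙-mono (no _)  Q?      _   = z≤n
𝟙-mono (yes p) (yes _) _   = s≤s z≤n
𝟙-mono (yes p) (no ¬q) P⇒Q = contradiction (P⇒Q p) ¬q

𝟙-⊎ : (P? : Dec P) (Q? : Dec Q) (R? : Dec R) → (P → Q ⊎ R) → 𝟙 P? ≤ 𝟙 Q? + 𝟙 R?
𝟙-⊎ (no _)  Q?      R? _ = z≤n
𝟙-⊎ (yes p) (yes _) R? _ = s≤s z≤n
𝟙-⊎ (yes p) (no ¬q) R? P⇒Q⊎R with P⇒Q⊎R p
... | inj₁ q = contradiction q ¬q
... | inj₂ r = 𝟙-mono (yes p) R? (λ _ → r)

𝟙-no+1≤𝟙-yes : (P? : Dec P) (Q? : Dec Q) → ¬ P → Q → 𝟙 P? + 1 ≤ 𝟙 Q?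
𝟙-no+1≤𝟙-yes (no _)  (yes _) _  _ = s≤s z≤n
𝟙-no+1≤𝟙-yes (yes p) _       ¬p _ = contradiction p ¬p
𝟙-no+1≤𝟙-yes (no _)  (no ¬q) _  q = contradiction q ¬q

∑-𝟙-∈ : (Y : Subset k) → ∑[ ℓ < k ] 𝟙 (ℓ ∈ˢ? Y) ≡ ∣ Y ∣
∑-𝟙-∈ Vec.[]            = refl
∑-𝟙-∈ (outside Vec.∷ Y) = ∑-𝟙-∈ Y
∑-𝟙-∈ (inside Vec.∷ Y)  = cong suc (∑-𝟙-∈ Y)

n≤2^⌈log2⌉ : ∀ n (rec : Acc _<_ n) → n ≤ 2 ^ ⌈log2⌉ n rec
n≤2^⌈log2⌉ 0 _ = z≤n
n≤2^⌈log2⌉ 1 _ = s≤s z≤n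
n≤2^⌈log2⌉ n@(suc (suc k)) (acc rs) = begin
  n                      ≡⟨ ⌊n/2⌋+⌈n/2⌉≡n n ⟨
  ⌊ n /2⌋ + ⌈ n /2⌉      ≤⟨ +-monoˡ-≤ ⌈ n /2⌉ (⌊n/2⌋≤⌈n/2⌉ n) ⟩
  ⌈ n /2⌉ + ⌈ n /2⌉      ≤⟨ +-mono-≤ half half ⟩
  2 ^ L + 2 ^ L          ≡⟨ cong (2 ^ L +_) (+-identityʳ (2 ^ L)) ⟨
  2 ^ suc L              ∎
  where
  open ≤-Reasoning
  L : ℕ
  L = ⌈log2⌉ ⌈ n /2⌉ (rs (⌈n/2⌉<n k))
  half : ⌈ n /2⌉ ≤ 2 ^ L
  half = n≤2^⌈log2⌉ ⌈ n /2⌉ (rs (⌈n/2⌉<n k))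

n<2^suc⌈log₂n⌉ : ∀ n → n < 2 ^ suc ⌈log₂ n ⌉
n<2^suc⌈log₂n⌉ n = begin-strict
  n                       <⟨ m<n+m n (m^n>0 2 ⌈log₂ n ⌉) ⟩
  2 ^ ⌈log₂ n ⌉ + n       ≤⟨ +-monoʳ-≤ (2 ^ ⌈log₂ n ⌉) (≤-trans n≤2^⌈log₂n⌉ (m≤m+n _ 0)) ⟩
  2 ^ suc ⌈log₂ n ⌉       ∎
  where
  open ≤-Reasoning
  n≤2^⌈log₂n⌉ : n ≤ 2 ^ ⌈log₂ n ⌉
  n≤2^⌈log₂n⌉ = n≤2^⌈log2⌉ n (<-wellFounded n)

*-≤-+-cancelˡ : ∀ W {k m r} → r < W → W * k ≤ W * m + r → k ≤ m
*-≤-+-cancelˡ W {k} {m} {r} r<W Wk≤Wm+r = s≤s⁻¹ (*-cancelˡ-< W k (suc m) (begin-strict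
  W * k       ≤⟨ Wk≤Wm+r ⟩
  W * m + r   <⟨ +-monoʳ-< (W * m) r<W ⟩
  W * m + W   ≡⟨ +-comm (W * m) W ⟩
  W + W * m   ≡⟨ *-suc W m ⟨
  W * suc m   ∎))
  where open ≤-Reasoning

module Potentials (m n : ℕ) (a : Fin (3 * m) → ℕ) (B : ℕ) (X : Fin n → Subset (3 * m)) where
  open Construction m n a B X
  open import Data.List.Membership.DecPropositional _≟ₑ_ using (_∈?_)

  Covered : List Edge → Elem → Set
  Covered prev x = Any (λ e → x ∈ elems e) prev

  covered? : ∀ prev x → Dec (Covered prev x)
  covered? prev x = any? (λ e → x ∈? elems e) prev

  covered : List Edge → Elem → ℕ
  covered prev x = 𝟙 (covered? prev x)

  slot : Edge → Fin m × Fin n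
  slot (A i j) = i , j
  slot (E i j) = i , j

  labelsOf : Fin n → List Elem
  labelsOf j = map α (filter (_∈ˢ? X j) (allFin (3 * m)))

  ∈-E⁻ : ∀ {x i j} → x ∈ elems (E i j) → (∃[ ℓ ] x ≡ α ℓ × ℓ ∈ˢ X j) ⊎ x ∈ ω i j ∷ τ i j ∷ []
  ∈-E⁻ {j = j} x∈ with ∈-++⁻ (labelsOf j) x∈
  ... | inj₂ x∈ωτ = inj₂ x∈ωτ
  ... | inj₁ x∈α with ∈-map∘filter⁻ α (_∈ˢ? X j) {xs = allFin (3 * m)} x∈α
  ...   | ℓ , _ , x≡αℓ , ℓ∈Xj = inj₁ (ℓ , x≡αℓ , ℓ∈Xj)

  ω∈⇒slot : ∀ {i j} e → ω i j ∈ elems e → (i , j) ≡ slot e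
  ω∈⇒slot (A _ _) (here refl) = refl
  ω∈⇒slot (E _ _) ω∈ with ∈-E⁻ ω∈
  ... | inj₁ (_ , () , _)
  ... | inj₂ (here refl) = refl
  ... | inj₂ (there (here ()))

  ω-slot∈ : ∀ e → uncurry ω (slot e) ∈ elems e
  ω-slot∈ (A _ _) = here refl
  ω-slot∈ (E _ j) = ∈-++⁺ʳ (labelsOf j) (here refl)

  τ∈E : ∀ {i j} → τ i j ∈ elems (E i j)
  τ∈E {j = j} = ∈-++⁺ʳ (labelsOf j) (there (here refl))

  τ∈⇒≡E : ∀ {i j} e → τ i j ∈ elems e → e ≡ E i j
  τ∈⇒≡E (A _ _) (here ())
  τ∈⇒≡E (E _ _) τ∈ with ∈-E⁻ τ∈
  ... | inj₁ (_ , () , _)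
  ... | inj₂ (there (here refl)) = refl

  α∉A : ∀ {ℓ i j} → ¬ α ℓ ∈ elems (A i j)
  α∉A (here ())

  α∈E⇒∈X : ∀ {ℓ i j} → α ℓ ∈ elems (E i j) → ℓ ∈ˢ X j
  α∈E⇒∈X α∈ with ∈-E⁻ α∈
  ... | inj₁ (_ , refl , ℓ∈Xj) = ℓ∈Xj
  ... | inj₂ (here ())
  ... | inj₂ (there (here ()))

  Covered-τ⇒Covered-E : ∀ {prev i j y} → Covered prev (τ i j) → y ∈ elems (E i j) → Covered prev y
  Covered-τ⇒Covered-E {y = y} τ-cov y∈ =
    Any.map (λ {e} τ∈ → subst (λ e → y ∈ elems e) (sym (τ∈⇒≡E e τ∈)) y∈) τ-cov

  ∈-residual⁺ : ∀ prev e {x} → x ∈ elems e → ¬ Covered prev x → x ∈ residual prev e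
  ∈-residual⁺ prev e = ∈-filter⁺ (¬? ∘ covered? prev)

  ∈-residual⁻ : ∀ prev e {x} → x ∈ residual prev e → x ∈ elems e × ¬ Covered prev x
  ∈-residual⁻ prev e = ∈-filter⁻ (¬? ∘ covered? prev) {xs = elems e}

  residual-≡-[] : ∀ {prev e} → (∀ {x} → x ∈ elems e → Covered prev x) → residual prev e ≡ []
  residual-≡-[] {prev} all-cov =
    filter-none (¬? ∘ covered? prev) (All.tabulate λ x∈ ¬cov → ¬cov (all-cov x∈))

  covered-∷-≤ : ∀ prev e x → covered (e ∷ prev) x ≤ covered prev x + 𝟙 (x ∈? residual prev e)
  covered-∷-≤ prev e x = 𝟙-⊎ (covered? (e ∷ prev) x) (covered? prev x) (x ∈? residual prev e) split
    where
    split : Covered (e ∷ prev) x → Covered prev x ⊎ x ∈ residual prev e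
    split (there cov) = inj₁ cov
    split (here x∈e) with covered? prev x
    ... | yes cov = inj₁ cov
    ... | no ¬cov = inj₂ (∈-residual⁺ prev e x∈e ¬cov)

  covered-∷-∉ : ∀ prev e {x} → ¬ x ∈ elems e → covered (e ∷ prev) x ≤ covered prev x
  covered-∷-∉ prev e {x} x∉e = 𝟙-mono (covered? (e ∷ prev) x) (covered? prev x) λ
    { (here x∈e)  → contradiction x∈e x∉e
    ; (there cov) → cov }

  covered-∷-mono : ∀ prev e x → covered prev x ≤ covered (e ∷ prev) x
  covered-∷-mono prev e x = 𝟙-mono (covered? prev x) (covered? (e ∷ prev) x) there

  covered-∷-new : ∀ prev e {x} → x ∈ residual prev e → covered prev x + 1 ≤ covered (e ∷ prev) x
  covered-∷-new prev e {x} x∈res =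
    𝟙-no+1≤𝟙-yes (covered? prev x) (covered? (e ∷ prev) x) ¬cov (here x∈e)
    where
    x∈e : x ∈ elems e
    x∈e = proj₁ (∈-residual⁻ prev e x∈res)
    ¬cov : ¬ Covered prev x
    ¬cov = proj₂ (∈-residual⁻ prev e x∈res)

  partialCost-≥-member : ∀ x R → 1 ≤ val x → 2 ^ val x * 𝟙 (x ∈? R) ≤ partialCost (sum (map val R))
  partialCost-≥-member x R 1≤val with x ∈? R
  ... | no _    = ≤-trans (≤-reflexive (*-zeroʳ (2 ^ val x))) z≤n
  ... | yes x∈R = begin
    2 ^ val x * 1                  ≡⟨ *-identityʳ _ ⟩
    2 ^ val x                      ≤⟨ ^-monoʳ-≤ 2 (sum-map-∈ val x∈R) ⟩
    2 ^ sum (map val R)            ≤⟨ 2^u≤partialCost (≤-trans 1≤val (sum-map-∈ val x∈R)) ⟩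
    partialCost (sum (map val R))  ∎
    where
    open ≤-Reasoning
    2^u≤partialCost : ∀ {u} → 1 ≤ u → 2 ^ u ≤ partialCost u
    2^u≤partialCost {suc u} _ = ≤-refl

  coveredω coveredτ coveredα : List Edge → ℕ
  coveredω prev = ∑[ i < m ] ∑[ j < n ] covered prev (ω i j)
  coveredτ prev = ∑[ i < m ] ∑[ j < n ] covered prev (τ i j)
  coveredα prev = ∑[ ℓ < 3 * m ] covered prev (α ℓ)

  nonemptyAssignment : List Edge → Edge → ℕ
  nonemptyAssignment prev (A _ _) = 0
  nonemptyAssignment prev (E i j) = 𝟙 (¬? (covered? prev (τ i j)))

  countFrom-∷ : ∀ prev e es →
                countFrom prev (e ∷ es) ≡ nonemptyAssignment prev e + countFrom (e ∷ prev) es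
  countFrom-∷ prev (A _ _) es = refl
  countFrom-∷ prev (E i j) es = cong (_+ countFrom (E i j ∷ prev) es) nonempty≡τ-uncovered
    where
    nonempty≡τ-uncovered : (if null (residual prev (E i j)) then 0 else 1) ≡ 𝟙 (¬? (covered? prev (τ i j)))
    nonempty≡τ-uncovered with covered? prev (τ i j)
    ... | yes τ-cov rewrite residual-≡-[] {prev} {E i j} (Covered-τ⇒Covered-E τ-cov) = refl
    ... | no ¬τ-cov with residual prev (E i j) | ∈-residual⁺ prev (E i j) τ∈E ¬τ-cov
    ...   | _ ∷ _ | _ = refl

  coveredω-∷ : ∀ prev e →
               2 ^ w * coveredω (e ∷ prev) ≤ 2 ^ w * coveredω prev + partialCost (residualWeight prev e)
  coveredω-∷ prev e = begin
    2 ^ w * coveredω (e ∷ prev)                                ≤⟨ *-monoʳ-≤ (2 ^ w) count-step ⟩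
    2 ^ w * (coveredω prev + 𝟙 (ω̂ ∈? residual prev e))         ≡⟨ *-distribˡ-+ (2 ^ w) _ _ ⟩
    2 ^ w * coveredω prev + 2 ^ w * 𝟙 (ω̂ ∈? residual prev e)   ≤⟨ +-monoʳ-≤ _ cost-step ⟩
    2 ^ w * coveredω prev + partialCost (residualWeight prev e) ∎
    where
    open ≤-Reasoning
    ω̂ : Elem
    ω̂ = uncurry ω (slot e)
    count-step : coveredω (e ∷ prev) ≤ coveredω prev + 𝟙 (ω̂ ∈? residual prev e)
    count-step = ≤-trans (≤-reflexive (sym (+-identityʳ _)))
      (∑²-≤-at (proj₁ (slot e)) (proj₂ (slot e))
        (λ i j ij≢slot → covered-∷-∉ prev e (ij≢slot ∘ ω∈⇒slot e))
        (≤-trans (≤-reflexive (+-identityʳ _)) (covered-∷-≤ prev e ω̂)))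
    cost-step : 2 ^ w * 𝟙 (ω̂ ∈? residual prev e) ≤ partialCost (residualWeight prev e)
    cost-step = partialCost-≥-member ω̂ (residual prev e) (m≤n+m 1 (t + B + ⌈log₂ m ⌉))

  coveredτ-mono : ∀ prev e → coveredτ prev ≤ coveredτ (e ∷ prev)
  coveredτ-mono prev e = ∑-mono-≤ λ i → ∑-mono-≤ λ j → covered-∷-mono prev e (τ i j)

  coveredτ-∷ : ∀ prev e → coveredτ prev + nonemptyAssignment prev e ≤ coveredτ (e ∷ prev)
  coveredτ-∷ prev e@(A _ _) = ≤-trans (≤-reflexive (+-identityʳ _)) (coveredτ-mono prev e)
  coveredτ-∷ prev e@(E i₀ j₀) with covered? prev (τ i₀ j₀)
  ... | yes _     = ≤-trans (≤-reflexive (+-identityʳ _)) (coveredτ-mono prev e)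
  ... | no ¬τ-cov = ≤-trans
    (∑²-≤-at i₀ j₀ (λ i j _ → covered-∷-mono prev e (τ i j))
      (≤-trans (covered-∷-new prev e (∈-residual⁺ prev e τ∈E ¬τ-cov)) (≤-reflexive (sym (+-identityʳ _)))))
    (≤-reflexive (+-identityʳ _))

  coveredτ≤coveredω : ∀ prev → coveredτ prev ≤ coveredω prev
  coveredτ≤coveredω prev = ∑-mono-≤ λ i → ∑-mono-≤ λ j →
    𝟙-mono (covered? prev (τ i j)) (covered? prev (ω i j))
           (λ τ-cov → Covered-τ⇒Covered-E τ-cov (ω-slot∈ (E i j)))

  residualLabels≤ : (∀ j → ∣ X j ∣ ≡ 3) → ∀ prev e →
                    ∑[ ℓ < 3 * m ] 𝟙 (α ℓ ∈? residual prev e) ≤ 3 * nonemptyAssignment prev e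
  residualLabels≤ _ prev e@(A _ _) = begin
    ∑[ ℓ < 3 * m ] 𝟙 (α ℓ ∈? residual prev e)   ≤⟨ ∑-mono-≤ none ⟩
    ∑[ ℓ < 3 * m ] 0                            ≡⟨ ∑-0 (3 * m) ⟩
    0                                           ∎
    where
    open ≤-Reasoning
    none : ∀ ℓ → 𝟙 (α ℓ ∈? residual prev e) ≤ 0
    none ℓ = 𝟙-mono (α ℓ ∈? residual prev e) (no λ ()) (α∉A ∘ proj₁ ∘ ∈-residual⁻ prev e)
  residualLabels≤ card prev e@(E i j) with covered? prev (τ i j)
  ... | yes τ-cov rewrite residual-≡-[] {prev} {e} (Covered-τ⇒Covered-E τ-cov) = ≤-reflexive (∑-0 (3 * m))
  ... | no _ = begin
    ∑[ ℓ < 3 * m ] 𝟙 (α ℓ ∈? residual prev e)   ≤⟨ ∑-mono-≤ within ⟩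
    ∑[ ℓ < 3 * m ] 𝟙 (ℓ ∈ˢ? X j)               ≡⟨ ∑-𝟙-∈ (X j) ⟩
    ∣ X j ∣                                    ≡⟨ card j ⟩
    3                                          ∎
    where
    open ≤-Reasoning
    within : ∀ ℓ → 𝟙 (α ℓ ∈? residual prev e) ≤ 𝟙 (ℓ ∈ˢ? X j)
    within ℓ = 𝟙-mono (α ℓ ∈? residual prev e) (ℓ ∈ˢ? X j) (α∈E⇒∈X ∘ proj₁ ∘ ∈-residual⁻ prev e)

  coveredα-∷ : (∀ j → ∣ X j ∣ ≡ 3) → ∀ prev e →
               coveredα (e ∷ prev) ≤ coveredα prev + 3 * nonemptyAssignment prev e
  coveredα-∷ card prev e = begin
    coveredα (e ∷ prev)
      ≤⟨ ∑-mono-≤ (λ ℓ → covered-∷-≤ prev e (α ℓ)) ⟩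
    ∑[ ℓ < 3 * m ] (covered prev (α ℓ) + 𝟙 (α ℓ ∈? residual prev e))
      ≡⟨ ∑-distrib-+ (λ ℓ → covered prev (α ℓ)) _ ⟩
    coveredα prev + ∑[ ℓ < 3 * m ] 𝟙 (α ℓ ∈? residual prev e)
      ≤⟨ +-monoʳ-≤ (coveredα prev) (residualLabels≤ card prev e) ⟩
    coveredα prev + 3 * nonemptyAssignment prev e
      ∎
    where open ≤-Reasoning

  -- reverseAcc prev es is the list of placed edges once es has been placed after prev,
  -- in the order in which costFrom and countFrom accumulate them.
  coveredω-reverseAcc : ∀ prev es →
                        2 ^ w * coveredω (reverseAcc prev es) ≤ 2 ^ w * coveredω prev + costFrom prev es
  coveredω-reverseAcc prev []       = m≤m+n _ 0
  coveredω-reverseAcc prev (e ∷ es) = begin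
    2 ^ w * coveredω (reverseAcc (e ∷ prev) es)
      ≤⟨ coveredω-reverseAcc (e ∷ prev) es ⟩
    2 ^ w * coveredω (e ∷ prev) + costFrom (e ∷ prev) es
      ≤⟨ +-monoˡ-≤ _ (coveredω-∷ prev e) ⟩
    2 ^ w * coveredω prev + partialCost (residualWeight prev e) + costFrom (e ∷ prev) es
      ≡⟨ +-assoc (2 ^ w * coveredω prev) _ _ ⟩
    2 ^ w * coveredω prev + costFrom prev (e ∷ es)
      ∎
    where open ≤-Reasoning

  coveredτ-reverseAcc : ∀ prev es → coveredτ prev + countFrom prev es ≤ coveredτ (reverseAcc prev es)
  coveredτ-reverseAcc prev []       = ≤-reflexive (+-identityʳ _)
  coveredτ-reverseAcc prev (e ∷ es) = begin
    coveredτ prev + countFrom prev (e ∷ es)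
      ≡⟨ cong (coveredτ prev +_) (countFrom-∷ prev e es) ⟩
    coveredτ prev + (nonemptyAssignment prev e + countFrom (e ∷ prev) es)
      ≡⟨ +-assoc (coveredτ prev) _ _ ⟨
    coveredτ prev + nonemptyAssignment prev e + countFrom (e ∷ prev) es
      ≤⟨ +-monoˡ-≤ _ (coveredτ-∷ prev e) ⟩
    coveredτ (e ∷ prev) + countFrom (e ∷ prev) es
      ≤⟨ coveredτ-reverseAcc (e ∷ prev) es ⟩
    coveredτ (reverseAcc (e ∷ prev) es)
      ∎
    where open ≤-Reasoning

  coveredα-reverseAcc : (∀ j → ∣ X j ∣ ≡ 3) → ∀ prev es →
                        coveredα (reverseAcc prev es) ≤ coveredα prev + 3 * countFrom prev es
  coveredα-reverseAcc card prev []       = m≤m+n _ _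
  coveredα-reverseAcc card prev (e ∷ es) = begin
    coveredα (reverseAcc (e ∷ prev) es)
      ≤⟨ coveredα-reverseAcc card (e ∷ prev) es ⟩
    coveredα (e ∷ prev) + 3 * countFrom (e ∷ prev) es
      ≤⟨ +-monoˡ-≤ _ (coveredα-∷ card prev e) ⟩
    coveredα prev + 3 * nonemptyAssignment prev e + 3 * countFrom (e ∷ prev) es
      ≡⟨ +-assoc (coveredα prev) _ _ ⟩
    coveredα prev + (3 * nonemptyAssignment prev e + 3 * countFrom (e ∷ prev) es)
      ≡⟨ cong (coveredα prev +_) (*-distribˡ-+ 3 (nonemptyAssignment prev e) _) ⟨
    coveredα prev + 3 * (nonemptyAssignment prev e + countFrom (e ∷ prev) es)
      ≡⟨ cong (λ c → coveredα prev + 3 * c) (countFrom-∷ prev e es) ⟨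
    coveredα prev + 3 * countFrom prev (e ∷ es)
      ∎
    where open ≤-Reasoning

  coveredω-[] : coveredω [] ≡ 0
  coveredω-[] = trans (sum-cong-≗ {m} λ _ → ∑-0 n) (∑-0 m)

  coveredα-covering : ∀ Es → IsCovering Es → coveredα (reverse Es) ≡ 3 * m
  coveredα-covering Es covers = trans (sum-cong-≗ {3 * m} all-covered) (∑-1 (3 * m))
    where
    all-covered : ∀ ℓ → covered (reverse Es) (α ℓ) ≡ 1
    all-covered ℓ = 𝟙-yes (covered? (reverse Es) (α ℓ)) (reverse⁺ (covers ℓ))

  -- This is what w = t + B + ⌈log₂ m⌉ + 1 is for: one more opening than m would exceed the
  -- slack m·2^(t+B) in C.
  m*2^[t+B]<2^w : m * 2 ^ (t + B) < 2 ^ w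
  m*2^[t+B]<2^w = begin-strict
    m * 2 ^ (t + B)          <⟨ *-monoˡ-< (2 ^ (t + B)) {{m^n≢0 2 (t + B)}} (n<2^suc⌈log₂n⌉ m) ⟩
    2 ^ suc L * 2 ^ (t + B)  ≡⟨ *-comm (2 ^ suc L) _ ⟩
    2 ^ (t + B) * 2 ^ suc L  ≡⟨ ^-distribˡ-+-* 2 (t + B) (suc L) ⟨
    2 ^ (t + B + suc L)      ≡⟨ cong (2 ^_) (trans (+-suc (t + B) L) (+-comm 1 (t + B + L))) ⟩
    2 ^ w                    ∎
    where
    open ≤-Reasoning
    L : ℕ
    L = ⌈log₂ m ⌉

  ≤C⇒≤m : ∀ k → 2 ^ w * k ≤ C → k ≤ m
  ≤C⇒≤m k 2^w*k≤C = *-≤-+-cancelˡ (2 ^ w) m*2^[t+B]<2^w (begin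
    2 ^ w * k                    ≤⟨ 2^w*k≤C ⟩
    m * (2 ^ w + 2 ^ (t + B))    ≡⟨ *-distribˡ-+ m (2 ^ w) _ ⟩
    m * 2 ^ w + m * 2 ^ (t + B)  ≡⟨ cong (_+ m * 2 ^ (t + B)) (*-comm m (2 ^ w)) ⟩
    2 ^ w * m + m * 2 ^ (t + B)  ∎)
    where open ≤-Reasoning

lemma2 : (m n : ℕ) (a : Fin (3 * m) → ℕ) (B : ℕ)
    → 0 < B
    → (∀ ℓ → 0 < a ℓ)
    → sum (map a (allFin (3 * m))) ≡ m * B
    → (∀ ℓ → B < 4 * a ℓ)
    → (∀ ℓ → 2 * a ℓ < B)
    → (X : Fin n → Subset (3 * m))
    → (∀ j → ∣ X j ∣ ≡ 3)
    → (∀ j → subsetWeight a (X j) ≡ B)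
    → (∀ j k → X j ≡ X k → j ≡ k)
    → (∀ (Y : Subset (3 * m)) → ∣ Y ∣ ≡ 3 → subsetWeight a Y ≡ B → ∃ λ j → X j ≡ Y)
    → (Es : List (Construction.Edge m n a B X))
    → Construction.IsCovering m n a B X Es
    → Construction.F m n a B X Es ≤ Construction.C m n a B X
    → Construction.nonemptyAssignments m n a B X Es ≡ m
lemma2 m n a B _ _ _ _ _ X card _ _ _ Es covers F≤C = ≤-antisym atMost atLeast
  where
  open Construction m n a B X
  open Potentials m n a B X
  open ≤-Reasoning
  count : ℕ
  count = nonemptyAssignments Es

  atMost : count ≤ m
  atMost = ≤C⇒≤m count (begin
    2 ^ w * count                  ≤⟨ *-monoʳ-≤ (2 ^ w) (≤-trans (m≤n+m count _) (coveredτ-reverseAcc [] Es)) ⟩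
    2 ^ w * coveredτ (reverse Es)  ≤⟨ *-monoʳ-≤ (2 ^ w) (coveredτ≤coveredω (reverse Es)) ⟩
    2 ^ w * coveredω (reverse Es)  ≤⟨ coveredω-reverseAcc [] Es ⟩
    2 ^ w * coveredω [] + F Es     ≡⟨ cong (λ c → 2 ^ w * c + F Es) coveredω-[] ⟩
    2 ^ w * 0 + F Es               ≡⟨ cong (_+ F Es) (*-zeroʳ (2 ^ w)) ⟩
    F Es                           ≤⟨ F≤C ⟩
    C                              ∎)

  atLeast : m ≤ count
  atLeast = *-cancelˡ-≤ 3 (begin
    3 * m                    ≡⟨ coveredα-covering Es covers ⟨
    coveredα (reverse Es)    ≤⟨ coveredα-reverseAcc card [] Es ⟩
    coveredα [] + 3 * count  ≡⟨ cong (_+ 3 * count) (∑-0 (3 * m)) ⟩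
    3 * count                ∎)
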